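{- In a full relational model over a set of states $\Sigma$ (states being valuations of program variables), the following inference rules for backward simulation judgments $c\mid d:P\overset{\exists\leftarrow}{\approx>}Q$ are sound, i.e., whenever the premises hold the conclusion holds (all $P,Q,R,S$ relations on $\Sigma$, $c,c',d,d'$ relations on $\Sigma$, $e,e'\subseteq\Sigma$ conditions): (bIf) if $c\mid c':P\wedge\langle e]\wedge[e'\rangle\overset{\exists\leftarrow}{\approx>}Q$ and $d\mid d':P\wedge\neg\langle e]\wedge\neg[e'\rangle\overset{\exists\leftarrow}{\approx>}Q$, then $\mathsf{if}\ e\ \mathsf{then}\ c\ \mathsf{else}\ d\mid\mathsf{if}\ e'\ \mathsf{then}\ c'\ \mathsf{else}\ d':P\overset{\exists\leftarrow}{\approx>}Q$; (bWh) if $c\mid c':P\wedge\langle e]\wedge[e'\rangle\overset{\exists\leftarrow}{\approx>}P$, then $\mathsf{while}\ e\ \mathsf{do}\ c\mid\mathsf{while}\ e'\ \mathsf{do}\ c':P\overset{\exists\leftarrow}{\approx>}P\wedge\neg\langle e]\wedge\neg[e'\rangle$; (bSeq) if $c\mid c':P\overset{\exists\leftarrow}{\approx>}R$ and $d\mid d':R\overset{\exists\leftarrow}{\approx>}Q$, then $c;d\mid c';d':P\overset{\exists\leftarrow}{\approx>}Q$; (bnAss) for program variables $x,y$, if $1\le[y:=\mathrm{any}\rangle;\dot R;[y:=\mathrm{any}\rangle$ then $x:=\mathrm{any}\mid y:=\mathrm{any}:R\overset{\exists\leftarrow}{\approx>}\mathit{true}$; (bConseq) if $R\subseteq P$, $c\mid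 d:R\overset{\exists\leftarrow}{\approx>}S$ and $Q\subseteq S$, then $c\mid d:P\overset{\exists\leftarrow}{\approx>}Q$; (bDisj) if $c\mid d:P\overset{\exists\leftarrow}{\approx>}Q$ and $c\mid d:P\overset{\exists\leftarrow}{\approx>}R$ then $c\mid d:P\overset{\exists\leftarrow}{\approx>}Q\vee R$.
   Context: $\Sigma$ is the set of states (functions from program variables to values). The full relational model has as actions all relations on $\Sigma$ and as tests all sub-identities; the full relational BiKAT has all relations on $\Sigma\times\Sigma$ and all sub-identities of $\Sigma\times\Sigma$ as bitests; $1$ is the identity, $;$ composition, $\le$ inclusion. The backward simulation judgment $c\mid d:P\overset{\exists\leftarrow}{\approx>}Q$ means $\forall\sigma,\tau,\tau'.\ \sigma\,c\,\tau\wedge\tau Q\tau'\Rightarrow\exists\sigma'.\ \sigma P\sigma'\wedge\sigma'\,d\,\tau'$. A condition $e\subseteq\Sigma$ is identified with the sub-identity $\{(\sigma,\sigma):\sigma\in e\}$; $\mathsf{if}\ e\ \mathsf{then}\ c\ \mathsf{else}\ d=e;c\cup\neg e;d$, $\mathsf{while}\ e\ \mathsf{do}\ c=(e;c)^*;\neg e$. $P\wedge\langle e]=\{(\sigma,\sigma')\in P:\sigma\in e\}$, $P\wedge[e'\rangle=\{(\sigma,\sigma')\in P:\sigma'\in e'\}$, negated versions use $\sigma\notin e$, $\sigma'\notin e'$; $\vee$ is union; $\mathit{true}=\Sigma\times\Sigma$. $x:=\mathrm{any}$ is the relation $\{(\sigma,\sigma[x\mapsto v])\}$ over all states $\sigma$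 and values $v$. In the BiKAT, $[a\rangle=id_\Sigma\otimes a$ with $(\sigma,\sigma')(R\otimes S)(\tau,\tau')$ iff $\sigma R\tau\wedge\sigma' S\tau'$, and $\dot R$ is the sub-identity containing $((\sigma,\sigma'),(\sigma,\sigma'))$ iff $\sigma R\sigma'$. -}

module Defs where

open import Level using (0ℓ)
open import Data.Product using (Σ; ∃; ∃-syntax; _×_; _,_)
open import Data.Sum using (_⊎_)
open import Data.Unit using (⊤)
open import Relation.Nullary using (¬_; yes; no)
open import Relation.Binary.Definitions using (DecidableEquality)
open import Relation.Binary.PropositionalEquality using (_≡_)
open import Relation.Binary.Construct.Closure.ReflexiveTransitive using (Star)

module Relational (Var Val : Set) (_≟_ : DecidableEquality Var) where

  State : Set
  State = Var → Val

  Rel : Set → Set₁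
  Rel A = A → A → Set

  Cond : Set₁
  Cond = State → Set

  upd : State → Var → Val → State
  upd σ x v y with y ≟ x
  ... | yes _ = v
  ... | no  _ = σ y

  idR : {A : Set} → Rel A
  idR a b = a ≡ b

  _⨾_ : {A : Set} → Rel A → Rel A → Rel A
  (r ⨾ s) a c = ∃[ b ] (r a b × s b c)

  _∪_ : {A : Set} → Rel A → Rel A → Rel A
  (r ∪ s) a b = r a b ⊎ s a b

  _⊆_ : {A : Set} → Rel A → Rel A → Set
  r ⊆ s = ∀ {a b} → r a b → s a b

  _⋆ : {A : Set} → Rel A → Rel A
  r ⋆ = Star r

  test : Cond → Rel State
  test e σ τ = e σ × σ ≡ τ

  neg : Cond → Cond
  neg e σ = ¬ e σ

  ifThenElse : Cond → Rel State → Rel State → Rel State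
  ifThenElse e c d = (test e ⨾ c) ∪ (test (neg e) ⨾ d)

  while : Cond → Rel State → Rel State
  while e c = ((test e ⨾ c) ⋆) ⨾ test (neg e)

  any : Var → Rel State
  any x σ τ = ∃[ v ] (τ ≡ upd σ x v)

  _∧⟨_] : Rel State → Cond → Rel State
  (P ∧⟨ e ]) σ σ' = P σ σ' × e σ

  _∧[_⟩ : Rel State → Cond → Rel State
  (P ∧[ e ⟩) σ σ' = P σ σ' × e σ'

  _∧¬⟨_] : Rel State → Cond → Rel State
  (P ∧¬⟨ e ]) σ σ' = P σ σ' × ¬ e σ

  _∧¬[_⟩ : Rel State → Cond → Rel State
  (P ∧¬[ e ⟩) σ σ' = P σ σ' × ¬ e σ'

  infixl 6 _∧⟨_] _∧[_⟩ _∧¬⟨_] _∧¬[_⟩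

  _∨_ : Rel State → Rel State → Rel State
  _∨_ = _∪_

  trueR : Rel State
  trueR _ _ = ⊤

  BSim : Rel State → Rel State → Rel State → Rel State → Set
  BSim c d P Q = ∀ σ τ τ' → c σ τ → Q τ τ' → ∃[ σ' ] (P σ σ' × d σ' τ')

  Pair : Set
  Pair = State × State

  _⊗_ : Rel State → Rel State → Rel Pair
  (R ⊗ S) (σ , σ') (τ , τ') = R σ τ × S σ' τ'

  -- [a⟩ = id ⊗ a
  right : Rel State → Rel Pair
  right a = idR ⊗ a

  dot : Rel State → Rel Pair
  dot R p q = R (Data.Product.proj₁ p) (Data.Product.proj₂ p) × p ≡ q

{-# OPTIONS --safe #-}
-- Backward simulations compose backwards: from a final pair (τ, τ') one first
-- pulls back through the second command and then through the first.  Tests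
-- are simulated with the strengthened postcondition P ∧ ⟨e] ∧ [e'⟩, unions
-- componentwise, and iteration by induction on the number of iterations with
-- P as invariant; conditionals and loops are built from these.  For (bnAss),
-- the hypothesis applied to the pair (σ, τ') yields the required σ' directly.
module Submission where

open import Defs
open import Data.Product using (_×_; _,_)
open import Data.Sum using (inj₁; inj₂)
open import Relation.Binary.Definitions using (DecidableEquality)
open import Relation.Binary.PropositionalEquality using (refl)
open import Relation.Binary.Construct.Closure.ReflexiveTransitive using (ε; _◅_)

module BackwardSimulation (Var Val : Set) (_≟_ : DecidableEquality Var) where
  open Relational Var Val _≟_

  bsim-test : ∀ {P : Rel State} (e e' : Cond) →
    BSim (test e) (test e') P ((P ∧⟨ e ]) ∧[ e' ⟩)
  bsim-test e e' σ σ τ' (_ , refl) ((p , _) , e'τ') = τ' , p , (e'τ' , refl)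

  bsim-⨾ : ∀ {P Q R c c' d d' : Rel State} →
    BSim c c' P R → BSim d d' R Q → BSim (c ⨾ d) (c' ⨾ d') P Q
  bsim-⨾ Hc Hd σ τ τ' (ρ , cσρ , dρτ) q with Hd ρ τ τ' dρτ q
  ... | ρ' , r , d'ρ'τ' with Hc σ ρ ρ' cσρ r
  ... | σ' , p , c'σ'ρ' = σ' , p , (ρ' , c'σ'ρ' , d'ρ'τ')

  bsim-∪ : ∀ {P Q c c' d d' : Rel State} →
    BSim c c' P Q → BSim d d' P Q → BSim (c ∪ d) (c' ∪ d') P Q
  bsim-∪ Hc Hd σ τ τ' (inj₁ cστ) q with Hc σ τ τ' cστ q
  ... | σ' , p , c'σ'τ' = σ' , p , inj₁ c'σ'τ'
  bsim-∪ Hc Hd σ τ τ' (inj₂ dστ) q with Hd σ τ τ' dστ q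
  ... | σ' , p , d'σ'τ' = σ' , p , inj₂ d'σ'τ'

  bsim-⋆ : ∀ {P c c' : Rel State} → BSim c c' P P → BSim (c ⋆) (c' ⋆) P P
  bsim-⋆ H σ σ τ' ε p = τ' , p , ε
  bsim-⋆ H σ τ τ' (cσρ ◅ c⋆ρτ) p with bsim-⋆ H _ τ τ' c⋆ρτ p
  ... | ρ' , pρ , c'⋆ρ'τ' with H σ _ ρ' cσρ pρ
  ... | σ' , pσ , c'σ'ρ' = σ' , pσ , (c'σ'ρ' ◅ c'⋆ρ'τ')

  bsim-guarded : ∀ {P Q c c' : Rel State} (e e' : Cond) →
    BSim c c' ((P ∧⟨ e ]) ∧[ e' ⟩) Q → BSim (test e ⨾ c) (test e' ⨾ c') P Q
  bsim-guarded e e' H = bsim-⨾ (bsim-test e e') H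

  bsim-if : ∀ {P Q c c' d d' : Rel State} (e e' : Cond) →
    BSim c c' ((P ∧⟨ e ]) ∧[ e' ⟩) Q →
    BSim d d' ((P ∧¬⟨ e ]) ∧¬[ e' ⟩) Q →
    BSim (ifThenElse e c d) (ifThenElse e' c' d') P Q
  bsim-if e e' Hc Hd =
    bsim-∪ (bsim-guarded e e' Hc) (bsim-guarded (neg e) (neg e') Hd)

  bsim-while : ∀ {P c c' : Rel State} (e e' : Cond) →
    BSim c c' ((P ∧⟨ e ]) ∧[ e' ⟩) P →
    BSim (while e c) (while e' c') P ((P ∧¬⟨ e ]) ∧¬[ e' ⟩)
  bsim-while e e' H =
    bsim-⨾ (bsim-⋆ (bsim-guarded e e' H)) (bsim-test (neg e) (neg e'))

  bsim-any : ∀ (x y : Var) {R : Rel State} →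
    idR ⊆ ((right (any y) ⨾ dot R) ⨾ right (any y)) →
    BSim (any x) (any y) R trueR
  bsim-any x y H σ τ τ' _ _ with H {σ , τ'} refl
  ... | _ , (_ , (refl , _) , (r , refl)) , (_ , anyσ'τ') = _ , r , anyσ'τ'

  bsim-conseq : ∀ {P Q R S c d : Rel State} →
    R ⊆ P → BSim c d R S → Q ⊆ S → BSim c d P Q
  bsim-conseq R⊆P H Q⊆S σ τ τ' cστ q with H σ τ τ' cστ (Q⊆S q)
  ... | σ' , r , dσ'τ' = σ' , R⊆P r , dσ'τ'

  bsim-∨ : ∀ {P Q R c d : Rel State} →
    BSim c d P Q → BSim c d P R → BSim c d P (Q ∨ R)
  bsim-∨ HQ HR σ τ τ' cστ (inj₁ q) = HQ σ τ τ' cστ q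
  bsim-∨ HQ HR σ τ τ' cστ (inj₂ r) = HR σ τ τ' cστ r

theorem7p9 : (Var Val : Set) (_≟_ : DecidableEquality Var) →
    let open Relational Var Val _≟_ in
    -- (bIf)
    (∀ (P Q c c' d d' : Rel State) (e e' : Cond) →
      BSim c c' ((P ∧⟨ e ]) ∧[ e' ⟩) Q →
      BSim d d' ((P ∧¬⟨ e ]) ∧¬[ e' ⟩) Q →
      BSim (ifThenElse e c d) (ifThenElse e' c' d') P Q)
    ×
    -- (bWh)
    (∀ (P c c' : Rel State) (e e' : Cond) →
      BSim c c' ((P ∧⟨ e ]) ∧[ e' ⟩) P →
      BSim (while e c) (while e' c') P ((P ∧¬⟨ e ]) ∧¬[ e' ⟩))
    ×
    -- (bSeq)
    (∀ (P Q R c c' d d' : Rel State) →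
      BSim c c' P R →
      BSim d d' R Q →
      BSim (c ⨾ d) (c' ⨾ d') P Q)
    ×
    -- (bnAss)
    (∀ (x y : Var) (R : Rel State) →
      idR ⊆ ((right (any y) ⨾ dot R) ⨾ right (any y)) →
      BSim (any x) (any y) R trueR)
    ×
    -- (bConseq)
    (∀ (P Q R S c d : Rel State) →
      R ⊆ P →
      BSim c d R S →
      Q ⊆ S →
      BSim c d P Q)
    ×
    -- (bDisj)
    (∀ (P Q R c d : Rel State) →
      BSim c d P Q →
      BSim c d P R →
      BSim c d P (Q ∨ R))
theorem7p9 Var Val _≟_ =
    (λ _ _ _ _ _ _ → bsim-if)
  , (λ _ _ _ → bsim-while)
  , (λ _ _ _ _ _ _ _ → bsim-⨾)
  , (λ x y _ → bsim-any x y)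
  , (λ _ _ _ _ _ _ → bsim-conseq)
  , (λ _ _ _ _ _ → bsim-∨)
  where open BackwardSimulation Var Val _≟_
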